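{- For every integer $k\ge 2$, the sequence $\{L_n^{(k)}\}_{n\in\mathbb{Z}}$ is periodic modulo $2$ with period $k+1$; that is, $L_n^{(k)}\equiv L_{n-(k+1)}^{(k)}\pmod 2$ for all $n\in\mathbb{Z}$.
   Context: For an integer $k\ge 2$, the $k$-Lucas sequence $\{L_n^{(k)}\}_{n\in\mathbb{Z}}$ is defined by $L_{2-k}^{(k)}=\cdots=L_{ -1}^{(k)}=0$, $L_0^{(k)}=2$, $L_1^{(k)}=1$, and the recurrence $L_n^{(k)}=L_{n-1}^{(k)}+L_{n-2}^{(k)}+\cdots+L_{n-k}^{(k)}$, which is imposed for all $n\in\mathbb{Z}$ (so that terms with index $<2-k$ are determined uniquely by running the recurrence backwards). -}

module Defs where

open import Data.Nat using (ℕ; zero; suc; _∸_)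
open import Data.Integer using (ℤ; +_; -[1+_]; _+_; _-_)
open import Data.List using (List; []; _∷_; _++_; replicate)
open import Function using (_∘_)

-- The k-Lucas sequence over ℤ, computed through a sliding window of the
-- last k values.  A window "at index n" is the list
--   [ L n , L (n-1) , … , L (n-k+1) ]   (length k).

sumℤ : List ℤ → ℤ
sumℤ []       = + 0
sumℤ (x ∷ xs) = x + sumℤ xs

dropLast : List ℤ → List ℤ
dropLast []           = []
dropLast (x ∷ [])     = []
dropLast (x ∷ y ∷ xs) = x ∷ dropLast (y ∷ xs)

-- window at index n  ↦  window at index n+1 :  L (n+1) = L n + … + L (n-k+1)
fwd : List ℤ → List ℤ
fwd w = sumℤ w ∷ dropLast w

-- window at index n  ↦  window at index n-1 :
--   L (n-k) = L n - (L (n-1) + … + L (n-k+1))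
bwd : List ℤ → List ℤ
bwd []       = []
bwd (a ∷ as) = as ++ (a - sumℤ as ∷ [])

iter : (List ℤ → List ℤ) → ℕ → List ℤ → List ℤ
iter f zero    w = w
iter f (suc m) w = f (iter f m w)

-- window at index 1 : [ L 1 , L 0 , L (-1) , … , L (2-k) ] = [1 , 2 , 0 , … , 0]
window₁ : ℕ → List ℤ
window₁ k = + 1 ∷ + 2 ∷ replicate (k ∸ 2) (+ 0)

-- window at index 1 + i
window : ℕ → ℤ → List ℤ
window k (+ m)      = iter fwd m (window₁ k)
window k -[1+ m ]   = iter bwd (suc m) (window₁ k)

headℤ : List ℤ → ℤ
headℤ []      = + 0
headℤ (x ∷ _) = x

kLucas : ℕ → ℤ → ℤ
kLucas k n = headℤ (window k (n - + 1))

-- Subtracting the recurrences for L (n+1) and L n gives L (n+1) + L (n-k) = 2 L n, so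
-- L (n+1) ≡ L (n-k) (mod 2).  In the sliding-window definition the window at n is
-- [L n, …, L (n-k+1)]; its head after one step is its sum, and its last entry is the head it had
-- k-1 steps earlier, which turns the identity into a statement about iterates of fwd.
{-# OPTIONS --safe #-}
module Submission where

open import Defs
open import Data.Nat using (ℕ; _≤_)
open import Data.Integer using (ℤ; +_; _-_)
open import Data.Integer.Divisibility using (_∣_)

import Data.Nat as ℕ
open import Data.Nat using (zero; suc; pred; _<_; _∸_; s≤s; z≤n)
import Data.Nat.Properties as ℕₚ
open import Data.Nat.Divisibility using (1∣_)
open import Data.Integer using (-[1+_]; _+_; _*_)
import Data.Integer.Properties as ℤₚ
open import Data.Integer.Divisibility using (*-monoʳ-∣)
open import Data.Integer.Tactic.RingSolver using (solve-∀)
open import Data.List using (List; []; _∷_; _++_; _∷ʳ_; length; drop)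
open import Data.List.Properties using (length-++; length-replicate)
open import Function using (_∘_)
open import Relation.Binary.PropositionalEquality
open ≡-Reasoning

sumℤ-++ : ∀ xs ys → sumℤ (xs ++ ys) ≡ sumℤ xs + sumℤ ys
sumℤ-++ []       ys = sym (ℤₚ.+-identityˡ (sumℤ ys))
sumℤ-++ (x ∷ xs) ys = begin
  x + sumℤ (xs ++ ys)      ≡⟨ cong (_+_ x) (sumℤ-++ xs ys) ⟩
  x + (sumℤ xs + sumℤ ys)  ≡⟨ ℤₚ.+-assoc x (sumℤ xs) (sumℤ ys) ⟨
  x + sumℤ xs + sumℤ ys    ∎

dropLast-∷ʳ : ∀ xs x → dropLast (xs ∷ʳ x) ≡ xs
dropLast-∷ʳ []           x = refl
dropLast-∷ʳ (y ∷ [])     x = refl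
dropLast-∷ʳ (y ∷ z ∷ xs) x = cong (y ∷_) (dropLast-∷ʳ (z ∷ xs) x)

length-dropLast : ∀ w → length (dropLast w) ≡ pred (length w)
length-dropLast []           = refl
length-dropLast (x ∷ [])     = refl
length-dropLast (x ∷ y ∷ xs) = cong suc (length-dropLast (y ∷ xs))

length-bwd : ∀ w → length (bwd w) ≡ length w
length-bwd []       = refl
length-bwd (x ∷ xs) = trans (length-++ xs) (ℕₚ.+-comm (length xs) 1)

-- Like headℤ, entry returns the junk value + 0 past the end of the list.
entry : List ℤ → ℕ → ℤ
entry w i = headℤ (drop i w)

lastℤ : List ℤ → ℤ
lastℤ w = entry w (pred (length w))

entry-dropLast : ∀ w i → suc i < length w → entry (dropLast w) i ≡ entry w i
entry-dropLast (x ∷ [])     zero    (s≤s ())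
entry-dropLast (x ∷ y ∷ xs) zero    _         = refl
entry-dropLast (x ∷ y ∷ xs) (suc i) (s≤s i<n) = entry-dropLast (y ∷ xs) i i<n

sumℤ-dropLast : ∀ w → sumℤ w ≡ sumℤ (dropLast w) + lastℤ w
sumℤ-dropLast []           = refl
sumℤ-dropLast (x ∷ [])     = ℤₚ.+-comm x (+ 0)
sumℤ-dropLast (x ∷ y ∷ xs) = begin
  x + sumℤ (y ∷ xs)                                ≡⟨ cong (_+_ x) (sumℤ-dropLast (y ∷ xs)) ⟩
  x + (sumℤ (dropLast (y ∷ xs)) + lastℤ (y ∷ xs))  ≡⟨ ℤₚ.+-assoc x _ _ ⟨
  x + sumℤ (dropLast (y ∷ xs)) + lastℤ (y ∷ xs)    ∎

-- For w = [L n, …, L (n-k+1)] this is L (n+2) + L (n-k+1) = 2 L (n+1).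
sumℤ-fwd : ∀ w → sumℤ (fwd w) + lastℤ w ≡ sumℤ w + sumℤ w
sumℤ-fwd w = begin
  sumℤ w + sumℤ (dropLast w) + lastℤ w    ≡⟨ ℤₚ.+-assoc (sumℤ w) _ _ ⟩
  sumℤ w + (sumℤ (dropLast w) + lastℤ w)  ≡⟨ cong (_+_ (sumℤ w)) (sumℤ-dropLast w) ⟨
  sumℤ w + sumℤ w                         ∎

fwd-bwd : ∀ {w m} → length w ≡ suc m → fwd (bwd w) ≡ w
fwd-bwd {x ∷ xs} _ = begin
  sumℤ (xs ∷ʳ y) ∷ dropLast (xs ∷ʳ y)  ≡⟨ cong₂ _∷_ (sumℤ-++ xs (y ∷ [])) (dropLast-∷ʳ xs y) ⟩
  sumℤ xs + (y + + 0) ∷ xs             ≡⟨ cong (_∷ xs) (cancel (sumℤ xs) x) ⟩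
  x ∷ xs                               ∎
  where
  y = x - sumℤ xs
  cancel : ∀ s x → s + ((x - s) + + 0) ≡ x
  cancel = solve-∀

length-iter-fwd : ∀ j {w m} → length w ≡ suc m → length (iter fwd j w) ≡ suc m
length-iter-fwd zero        len = len
length-iter-fwd (suc j) {w} len = begin
  suc (length (dropLast (iter fwd j w)))  ≡⟨ cong suc (length-dropLast (iter fwd j w)) ⟩
  suc (pred (length (iter fwd j w)))      ≡⟨ cong (suc ∘ pred) (length-iter-fwd j len) ⟩
  suc _                                   ∎

length-iter-bwd : ∀ j w → length (iter bwd j w) ≡ length w
length-iter-bwd zero    w = refl
length-iter-bwd (suc j) w = trans (length-bwd (iter bwd j w)) (length-iter-bwd j w)

entry-iter-fwd : ∀ j w → j < length w → entry (iter fwd j w) j ≡ headℤ w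
entry-iter-fwd zero    w        _   = refl
entry-iter-fwd (suc j) (x ∷ xs) j<n = begin
  entry (dropLast (iter fwd j (x ∷ xs))) j  ≡⟨ entry-dropLast _ j 1+j<len ⟩
  entry (iter fwd j (x ∷ xs)) j             ≡⟨ entry-iter-fwd j (x ∷ xs) (ℕₚ.<⇒≤ j<n) ⟩
  x                                         ∎
  where
  1+j<len : suc j < length (iter fwd j (x ∷ xs))
  1+j<len = subst (suc j <_) (sym (length-iter-fwd j refl)) j<n

head-iter-fwd-recurrence : ∀ k w → 0 < k → length w ≡ k →
  headℤ (iter fwd (suc k) w) + headℤ w ≡ headℤ (iter fwd k w) + headℤ (iter fwd k w)
head-iter-fwd-recurrence (suc m) w _ len = begin
  sumℤ (fwd v) + headℤ w  ≡⟨ cong (_+_ (sumℤ (fwd v))) lastℤ-v ⟨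
  sumℤ (fwd v) + lastℤ v  ≡⟨ sumℤ-fwd v ⟩
  sumℤ v + sumℤ v         ∎
  where
  v = iter fwd m w
  lastℤ-v : lastℤ v ≡ headℤ w
  lastℤ-v = begin
    entry v (pred (length v))  ≡⟨ cong (entry v ∘ pred) (length-iter-fwd m len) ⟩
    entry v m                  ≡⟨ entry-iter-fwd m w (ℕₚ.≤-reflexive (sym len)) ⟩
    headℤ w                    ∎

window-suc : ∀ k i → window k (i + + 1) ≡ fwd (window k i)
window-suc k (+ m)        = cong (λ j → iter fwd j (window₁ k)) (ℕₚ.+-comm m 1)
window-suc k -[1+ zero ]  = sym (fwd-bwd refl)
window-suc k -[1+ suc m ] = sym (fwd-bwd (length-iter-bwd (suc m) (window₁ k)))

window-+ : ∀ k i j → window k (i + + j) ≡ iter fwd j (window k i)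
window-+ k i zero    = cong (window k) (ℤₚ.+-identityʳ i)
window-+ k i (suc j) = begin
  window k (i + + suc j)         ≡⟨ cong (window k) i+[1+j]≡i+j+1 ⟩
  window k (i + + j + + 1)       ≡⟨ window-suc k (i + + j) ⟩
  fwd (window k (i + + j))       ≡⟨ cong fwd (window-+ k i j) ⟩
  fwd (iter fwd j (window k i))  ∎
  where
  i+[1+j]≡i+j+1 : i + + suc j ≡ i + + j + + 1
  i+[1+j]≡i+j+1 = begin
    i + (+ 1 + + j)  ≡⟨ cong (_+_ i) (ℤₚ.+-comm (+ 1) (+ j)) ⟩
    i + (+ j + + 1)  ≡⟨ ℤₚ.+-assoc i (+ j) (+ 1) ⟨
    i + + j + + 1    ∎

length-window₁ : ∀ k → 2 ≤ k → length (window₁ k) ≡ k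
length-window₁ k 2≤k = trans (cong (suc ∘ suc) (length-replicate (k ∸ 2))) (ℕₚ.m+[n∸m]≡n 2≤k)

length-window : ∀ k → 2 ≤ k → ∀ i → length (window k i) ≡ k
length-window k 2≤k (+ m)    = trans (length-iter-fwd m refl) (length-window₁ k 2≤k)
length-window k 2≤k -[1+ m ] = trans (length-iter-bwd (suc m) (window₁ k)) (length-window₁ k 2≤k)

i+j≡k+k⇒2∣i-j : ∀ i j k → i + j ≡ k + k → + 2 ∣ i - j
i+j≡k+k⇒2∣i-j i j k i+j≡k+k = subst (+ 2 ∣_) (sym i-j≡2[k-j]) (*-monoʳ-∣ (+ 2) {+ 1} {k - j} (1∣ _))
  where
  regroup : ∀ i j → i - j ≡ (i + j) - (j + j)
  regroup = solve-∀
  factor : ∀ k j → (k + k) - (j + j) ≡ + 2 * (k - j)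
  factor = solve-∀
  i-j≡2[k-j] : i - j ≡ + 2 * (k - j)
  i-j≡2[k-j] = begin
    i - j              ≡⟨ regroup i j ⟩
    (i + j) - (j + j)  ≡⟨ cong (_- (j + j)) i+j≡k+k ⟩
    (k + k) - (j + j)  ≡⟨ factor k j ⟩
    + 2 * (k - j)      ∎

lemma2p1 : ∀ (k : ℕ) → 2 ≤ k → ∀ (n : ℤ) →
    (+ 2) ∣ (kLucas k n - kLucas k (n - + (Data.Nat._+_ k 1)))
lemma2p1 k 2≤k n = i+j≡k+k⇒2∣i-j (kLucas k n) (kLucas k (n - K)) (headℤ (iter fwd k w)) (begin
  headℤ (window k (n - + 1)) + headℤ w         ≡⟨ cong (λ v → headℤ v + headℤ w) window-at-n-1 ⟩
  headℤ (iter fwd (suc k) w) + headℤ w         ≡⟨ head-iter-fwd-recurrence k w 0<k (length-window k 2≤k i) ⟩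
  headℤ (iter fwd k w) + headℤ (iter fwd k w)  ∎)
  where
  K = + (k ℕ.+ 1)
  i = n - K - + 1
  w = window k i
  0<k : 0 < k
  0<k = ℕₚ.<-≤-trans (s≤s z≤n) 2≤k
  reindex : ∀ n K → n - + 1 ≡ n - K - + 1 + K
  reindex = solve-∀
  window-at-n-1 : window k (n - + 1) ≡ iter fwd (suc k) w
  window-at-n-1 = begin
    window k (n - + 1)    ≡⟨ cong (window k) (reindex n K) ⟩
    window k (i + K)      ≡⟨ window-+ k i (k ℕ.+ 1) ⟩
    iter fwd (k ℕ.+ 1) w  ≡⟨ cong (λ j → iter fwd j w) (ℕₚ.+-comm k 1) ⟩
    iter fwd (suc k) w    ∎
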